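{- For any integer $k\geq 1$ and any odd integer $\ell\geq 3$: if the odd graph $O_{2k+1}$ has a $\mathcal{C}_\ell$-factor, then the middle levels graph $M_{2k+1}$ has a $\mathcal{C}_{2\ell}$-factor.
   Context: The odd graph $O_{2k+1}$ has as vertices all $k$-element subsets of $\{1,2,\ldots,2k+1\}$, with an edge between any two disjoint sets. The middle levels graph $M_{2k+1}$ has as vertices all $k$-element and all $(k+1)$-element subsets of $\{1,2,\ldots,2k+1\}$, with an edge between two sets if one is a subset of the other. For a graph $G$ with $n$ vertices, a $\mathcal{C}_m$-factor of $G$ is a collection of $n/m$ pairwise vertex-disjoint cycles in $G$, each of length $m$. -}

module Defs where

open import Data.Nat using (ℕ; suc; _+_; _*_; NonZero)
open import Data.Nat.DivMod using (_%_; m%n<n)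
open import Data.Fin using (Fin; toℕ; fromℕ<)
open import Data.Fin.Subset using (Subset; ∣_∣; _⊆_; _∩_; Empty)
open import Data.Product using (Σ; _×_; _,_; ∃; proj₁)
open import Data.Sum using (_⊎_)
open import Relation.Binary.PropositionalEquality using (_≡_)

record Graph : Set₁ where
  field
    V   : Set
    Adj : V → V → Set

open Graph public

next : ∀ {m} .{{_ : NonZero m}} → Fin m → Fin m
next {m} i = fromℕ< (m%n<n (suc (toℕ i)) m)

-- A C_m-factor of G: c cycles, cycle j visiting vertices cyc j 0, …, cyc j (m-1)
-- with consecutive (cyclically) vertices adjacent, such that the map
-- (j , i) ↦ cyc j i is a bijection onto the vertex set (so the cycles are
-- pairwise vertex-disjoint, each has m distinct vertices, and they cover V).
record CFactor (m : ℕ) .{{_ : NonZero m}} (G : Graph) : Set where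
  field
    c        : ℕ
    cyc      : Fin c → Fin m → V G
    adjacent : ∀ j i → Adj G (cyc j i) (cyc j (next i))
    injective : ∀ j i j′ i′ → cyc j i ≡ cyc j′ i′ → (j ≡ j′) × (i ≡ i′)
    surjective : ∀ v → ∃ λ j → ∃ λ i → cyc j i ≡ v

OddGraph : ℕ → Graph
OddGraph k = record
  { V   = Σ (Subset (suc (2 * k))) (λ s → ∣ s ∣ ≡ k)
  ; Adj = λ x y → Empty (proj₁ x ∩ proj₁ y)
  }

MiddleLevels : ℕ → Graph
MiddleLevels k = record
  { V   = Σ (Subset (suc (2 * k))) (λ s → (∣ s ∣ ≡ k) ⊎ (∣ s ∣ ≡ suc k))
  ; Adj = λ x y → (proj₁ x ⊆ proj₁ y) ⊎ (proj₁ y ⊆ proj₁ x)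
  }

module Submission where

-- Complementing the (k+1)-sets identifies the middle levels graph M_{2k+1} with the
-- bipartite double cover O_{2k+1} × K₂: a k-set s on side 0 and a k-set t on side 1,
-- standing for ∁ t, are adjacent in M_{2k+1} exactly when s ∩ t = ∅.  In a double
-- cover a cycle v₀ … v_{ℓ-1} lifts to the closed walk p ↦ (v_{p mod ℓ}, p mod 2) of
-- length 2ℓ.  For odd ℓ the map p ↦ (p mod ℓ, p mod 2) is a bijection
-- ℤ_{2ℓ} ≅ ℤ_ℓ × ℤ₂ (Chinese remainder theorem), so the walk is a cycle, and the lifts
-- of the cycles of a C_ℓ-factor are disjoint and cover the double cover.

open import Defs
open import Algebra.Lattice.Properties.BooleanAlgebra as BooleanAlgebraProperties using ()
open import Data.Empty using (⊥-elim)
open import Data.Fin using (Fin; toℕ; fromℕ<)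
open import Data.Fin.Properties using (toℕ-fromℕ<; toℕ-injective; toℕ<n; fromℕ<-cong)
open import Data.Fin.Subset using (Subset; ∣_∣; _⊆_; _∩_; Empty; ∁)
open import Data.Fin.Subset.Properties using (x∉p⇒x∈∁p; x∈p∩q⁺; ∣∁p∣≡n∸∣p∣; ∪-∩-booleanAlgebra)
open import Data.Nat using (ℕ; suc; _+_; _*_; _∸_; _<_; _≤_; NonZero; parity; s≤s; z≤n)
open import Data.Nat.Divisibility using (_∣_; divides; m∣m*n; n∣m*n)
open import Data.Nat.DivMod using (_%_; _/_; _mod_; m≡m%n+[m/n]*n; [m+kn]%n≡m%n; m<n⇒m%n≡m;
  m∣n⇒o%n%m≡o%m; m<n*o⇒m/o<n)
open import Data.Nat.Properties using (≡-irrelevant; m+n∸m≡n; +-suc; +-identityʳ; m+n∸n≡m; +-monoˡ-<;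
  +-monoʳ-≤; ≤-trans; 1+n≢n)
open import Data.Parity using (Parity; 0ℙ; 1ℙ; _⁻¹)
  renaming (_+_ to _+ℙ_; _*_ to _*ℙ_)
open import Data.Parity.Properties using (+-homo-+; *-homo-*; suc-homo-⁻¹; ⁻¹-involutive; *-zeroʳ;
  *-identityʳ) renaming (+-identityʳ to +ℙ-identityʳ)
open import Data.Product using (Σ; _×_; _,_; proj₁; proj₂; map₁)
open import Data.Sum using (inj₁; inj₂)
open import Function using (_∘_)
open import Function.Definitions using (Injective; StrictlySurjective)
open import Relation.Binary.PropositionalEquality

open ≡-Reasoning

suc[m%n]%n≡suc[m]%n : ∀ m n .{{_ : NonZero n}} → suc (m % n) % n ≡ suc m % n
suc[m%n]%n≡suc[m]%n m n = begin
  suc (m % n) % n             ≡⟨ [m+kn]%n≡m%n (suc (m % n)) (m / n) n ⟨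
  suc (m % n + m / n * n) % n ≡⟨ cong (λ x → suc x % n) (m≡m%n+[m/n]*n m n) ⟨
  suc m % n                   ∎

parity-even : ∀ {n} → 2 ∣ n → parity n ≡ 0ℙ
parity-even (divides q refl) = trans (*-homo-* q 2) (*-zeroʳ (parity q))

parity-%-even : ∀ m {n} .{{_ : NonZero n}} → 2 ∣ n → parity (m % n) ≡ parity m
parity-%-even m {n} 2∣n = sym (begin
  parity m                                        ≡⟨ cong parity (m≡m%n+[m/n]*n m n) ⟩
  parity (m % n + m / n * n)                      ≡⟨ +-homo-+ (m % n) (m / n * n) ⟩
  parity (m % n) +ℙ parity (m / n * n)            ≡⟨ cong (parity (m % n) +ℙ_) (*-homo-* (m / n) n) ⟩
  parity (m % n) +ℙ (parity (m / n) *ℙ parity n)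
    ≡⟨ cong (λ p → parity (m % n) +ℙ (parity (m / n) *ℙ p)) (parity-even 2∣n) ⟩
  parity (m % n) +ℙ (parity (m / n) *ℙ 0ℙ)        ≡⟨ cong (parity (m % n) +ℙ_) (*-zeroʳ (parity (m / n))) ⟩
  parity (m % n) +ℙ 0ℙ                            ≡⟨ +ℙ-identityʳ (parity (m % n)) ⟩
  parity (m % n)                                  ∎)

parity-odd : ∀ m → parity (suc (2 * m)) ≡ 1ℙ
parity-odd m = trans (sym (suc-homo-⁻¹ (suc (2 * m)))) (cong _⁻¹ (parity-even (m∣m*n m)))

toℕ-mod : ∀ m n .{{_ : NonZero n}} → toℕ (m mod n) ≡ m % n
toℕ-mod m n = toℕ-fromℕ< _

mod-next : ∀ {N ℓ} .{{_ : NonZero N}} .{{_ : NonZero ℓ}} → ℓ ∣ N →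
           (p : Fin N) → toℕ (next p) mod ℓ ≡ next (toℕ p mod ℓ)
mod-next {N} {ℓ} ℓ∣N p = fromℕ<-cong _ _ (begin
  toℕ (next p) % ℓ            ≡⟨ cong (_% ℓ) (toℕ-mod (suc (toℕ p)) N) ⟩
  suc (toℕ p) % N % ℓ         ≡⟨ m∣n⇒o%n%m≡o%m ℓ N (suc (toℕ p)) ℓ∣N ⟩
  suc (toℕ p) % ℓ             ≡⟨ suc[m%n]%n≡suc[m]%n (toℕ p) ℓ ⟨
  suc (toℕ p % ℓ) % ℓ         ≡⟨ cong (λ x → suc x % ℓ) (toℕ-mod (toℕ p) ℓ) ⟨
  suc (toℕ (toℕ p mod ℓ)) % ℓ ∎) _ _

parity-next : ∀ {N} .{{_ : NonZero N}} → 2 ∣ N →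
              (p : Fin N) → parity (toℕ (next p)) ≡ parity (toℕ p) ⁻¹
parity-next {N} 2∣N p = begin
  parity (toℕ (next p))    ≡⟨ cong parity (toℕ-mod (suc (toℕ p)) N) ⟩
  parity (suc (toℕ p) % N) ≡⟨ parity-%-even (suc (toℕ p)) 2∣N ⟩
  parity (suc (toℕ p))     ≡⟨ suc-homo-⁻¹ (suc (toℕ p)) ⟨
  parity (toℕ p) ⁻¹        ∎

bit : Parity → ℕ
bit 0ℙ = 0
bit 1ℙ = 1

parity-bit : ∀ q → parity (bit q) ≡ q
parity-bit 0ℙ = refl
parity-bit 1ℙ = refl

bit-parity : ∀ {d} → d < 2 → bit (parity d) ≡ d
bit-parity {0}           _               = refl
bit-parity {1}           _               = refl
bit-parity {suc (suc _)} (s≤s (s≤s ()))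

+-bit*-< : ∀ {i ℓ} q → i < ℓ → i + bit q * ℓ < 2 * ℓ
+-bit*-< {ℓ = ℓ} 0ℙ i<ℓ = ≤-trans (+-monoˡ-< 0 i<ℓ) (+-monoʳ-≤ ℓ z≤n)
+-bit*-< {ℓ = ℓ} 1ℙ i<ℓ = +-monoˡ-< (ℓ + 0) i<ℓ

p+[p+q]≡q : ∀ p q → p +ℙ (p +ℙ q) ≡ q
p+[p+q]≡q 0ℙ q = refl
p+[p+q]≡q 1ℙ q = ⁻¹-involutive q

module ChineseRemainder (ℓ : ℕ) .{{_ : NonZero ℓ}} (ℓ-odd : parity ℓ ≡ 1ℙ) where

  split : Fin (2 * ℓ) → Fin ℓ × Parity
  split p = toℕ p mod ℓ , parity (toℕ p)

  -- Adding the odd ℓ keeps the residue mod ℓ and flips the parity.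
  join : Fin ℓ × Parity → Fin (2 * ℓ)
  join (i , q) = fromℕ< (+-bit*-< (parity (toℕ i) +ℙ q) (toℕ<n i))

  parity-+*ℓ : ∀ i d → parity (i + d * ℓ) ≡ parity i +ℙ parity d
  parity-+*ℓ i d = begin
    parity (i + d * ℓ)                 ≡⟨ +-homo-+ i (d * ℓ) ⟩
    parity i +ℙ parity (d * ℓ)         ≡⟨ cong (parity i +ℙ_) (*-homo-* d ℓ) ⟩
    parity i +ℙ (parity d *ℙ parity ℓ) ≡⟨ cong (λ q → parity i +ℙ (parity d *ℙ q)) ℓ-odd ⟩
    parity i +ℙ (parity d *ℙ 1ℙ)       ≡⟨ cong (parity i +ℙ_) (*-identityʳ (parity d)) ⟩
    parity i +ℙ parity d               ∎

  split-join : ∀ x → split (join x) ≡ x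
  split-join (i , q) = cong₂ _,_ (toℕ-injective remainder) parity-join
    where
    r = parity (toℕ i) +ℙ q

    toℕ-join : toℕ (join (i , q)) ≡ toℕ i + bit r * ℓ
    toℕ-join = toℕ-fromℕ< _

    remainder : toℕ (toℕ (join (i , q)) mod ℓ) ≡ toℕ i
    remainder = begin
      toℕ (toℕ (join (i , q)) mod ℓ) ≡⟨ toℕ-mod (toℕ (join (i , q))) ℓ ⟩
      toℕ (join (i , q)) % ℓ         ≡⟨ cong (_% ℓ) toℕ-join ⟩
      (toℕ i + bit r * ℓ) % ℓ        ≡⟨ [m+kn]%n≡m%n (toℕ i) (bit r) ℓ ⟩
      toℕ i % ℓ                      ≡⟨ m<n⇒m%n≡m (toℕ<n i) ⟩
      toℕ i                          ∎

    parity-join : parity (toℕ (join (i , q))) ≡ q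
    parity-join = begin
      parity (toℕ (join (i , q)))       ≡⟨ cong parity toℕ-join ⟩
      parity (toℕ i + bit r * ℓ)        ≡⟨ parity-+*ℓ (toℕ i) (bit r) ⟩
      parity (toℕ i) +ℙ parity (bit r)  ≡⟨ cong (parity (toℕ i) +ℙ_) (parity-bit r) ⟩
      parity (toℕ i) +ℙ r               ≡⟨ p+[p+q]≡q (parity (toℕ i)) q ⟩
      q                                 ∎

  join-split : ∀ p → join (split p) ≡ p
  join-split p = toℕ-injective (begin
    toℕ (join (split p))                          ≡⟨ toℕ-fromℕ< _ ⟩
    toℕ (toℕ p mod ℓ) + bit (parity (toℕ (toℕ p mod ℓ)) +ℙ parity (toℕ p)) * ℓ
      ≡⟨ cong (λ i → i + bit (parity i +ℙ parity (toℕ p)) * ℓ) (toℕ-mod (toℕ p) ℓ) ⟩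
    r + bit (parity r +ℙ parity (toℕ p)) * ℓ     ≡⟨ cong (λ x → r + bit x * ℓ) parity-quotient ⟩
    r + bit (parity d) * ℓ                       ≡⟨ cong (λ x → r + x * ℓ) (bit-parity (m<n*o⇒m/o<n (toℕ<n p))) ⟩
    r + d * ℓ                                    ≡⟨ m≡m%n+[m/n]*n (toℕ p) ℓ ⟨
    toℕ p                                        ∎)
    where
    r = toℕ p % ℓ
    d = toℕ p / ℓ

    parity-quotient : parity r +ℙ parity (toℕ p) ≡ parity d
    parity-quotient = begin
      parity r +ℙ parity (toℕ p)              ≡⟨ cong (λ x → parity r +ℙ parity x) (m≡m%n+[m/n]*n (toℕ p) ℓ) ⟩
      parity r +ℙ parity (r + d * ℓ)          ≡⟨ cong (parity r +ℙ_) (parity-+*ℓ r d) ⟩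
      parity r +ℙ (parity r +ℙ parity d)      ≡⟨ p+[p+q]≡q (parity r) (parity d) ⟩
      parity d                                ∎

  split-injective : ∀ {p p′} → split p ≡ split p′ → p ≡ p′
  split-injective {p} {p′} e = begin
    p                ≡⟨ join-split p ⟨
    join (split p)   ≡⟨ cong join e ⟩
    join (split p′)  ≡⟨ join-split p′ ⟩
    p′               ∎

DoubleCover : Graph → Graph
DoubleCover G = record
  { V   = V G × Parity
  ; Adj = λ x y → Adj G (proj₁ x) (proj₁ y) × proj₂ y ≡ proj₂ x ⁻¹
  }

doubleCover-CFactor : ∀ m {G} → CFactor (suc (2 * m)) G → CFactor (2 * suc (2 * m)) (DoubleCover G)
doubleCover-CFactor m {G} F = record
  { c          = F.c
  ; cyc        = lift
  ; adjacent   = adjacent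
  ; injective  = injective
  ; surjective = surjective
  }
  where
  module F = CFactor F
  ℓ = suc (2 * m)
  open ChineseRemainder ℓ (parity-odd m)

  lift : Fin F.c → Fin (2 * ℓ) → V G × Parity
  lift j = map₁ (F.cyc j) ∘ split

  adjacent : ∀ j p → Adj (DoubleCover G) (lift j p) (lift j (next p))
  adjacent j p = subst (Adj G (F.cyc j (toℕ p mod ℓ)) ∘ F.cyc j) (sym (mod-next (n∣m*n 2) p))
                       (F.adjacent j (toℕ p mod ℓ))
               , parity-next (m∣m*n ℓ) p

  injective : ∀ j p j′ p′ → lift j p ≡ lift j′ p′ → j ≡ j′ × p ≡ p′
  injective j p j′ p′ e with F.injective j _ j′ _ (cong proj₁ e)
  ... | refl , i≡i′ = refl , split-injective (cong₂ _,_ i≡i′ (cong proj₂ e))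

  surjective : ∀ v → Σ (Fin F.c) λ j → Σ (Fin (2 * ℓ)) λ p → lift j p ≡ v
  surjective (v , q) with F.surjective v
  ... | j , i , refl = j , join (i , q) , cong (map₁ (F.cyc j)) (split-join (i , q))

CFactor-map : ∀ {m} .{{_ : NonZero m}} {G H : Graph} (f : V G → V H) →
              Injective _≡_ _≡_ f → StrictlySurjective _≡_ f →
              (∀ {u v} → Adj G u v → Adj H (f u) (f v)) →
              CFactor m G → CFactor m H
CFactor-map f f-injective f-surjective f-adj F = record
  { c          = F.c
  ; cyc        = λ j i → f (F.cyc j i)
  ; adjacent   = λ j i → f-adj (F.adjacent j i)
  ; injective  = λ j i j′ i′ → F.injective j i j′ i′ ∘ f-injective
  ; surjective = λ w → let u , fu≡w = f-surjective w
                           j , i , cyc≡u = F.surjective u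
                       in j , i , trans (cong f cyc≡u) fu≡w
  }
  where module F = CFactor F

∁-involutive : ∀ {n} (s : Subset n) → ∁ (∁ s) ≡ s
∁-involutive {n} = BooleanAlgebraProperties.¬-involutive (∪-∩-booleanAlgebra n)

∁-injective : ∀ {n} {s t : Subset n} → ∁ s ≡ ∁ t → s ≡ t
∁-injective {s = s} {t} e = begin
  s          ≡⟨ ∁-involutive s ⟨
  ∁ (∁ s)    ≡⟨ cong ∁ e ⟩
  ∁ (∁ t)    ≡⟨ ∁-involutive t ⟩
  t          ∎

Empty[p∩q]⇒p⊆∁q : ∀ {n} {p q : Subset n} → Empty (p ∩ q) → p ⊆ ∁ q
Empty[p∩q]⇒p⊆∁q p∩q≡∅ x∈p = x∉p⇒x∈∁p (λ x∈q → p∩q≡∅ (_ , x∈p∩q⁺ (x∈p , x∈q)))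

Empty[p∩q]⇒q⊆∁p : ∀ {n} {p q : Subset n} → Empty (p ∩ q) → q ⊆ ∁ p
Empty[p∩q]⇒q⊆∁p p∩q≡∅ x∈q = x∉p⇒x∈∁p (λ x∈p → p∩q≡∅ (_ , x∈p∩q⁺ (x∈p , x∈q)))

module _ (k : ℕ) where

  2k+1≡k+[1+k] : suc (2 * k) ≡ k + suc k
  2k+1≡k+[1+k] = trans (cong (λ x → suc (k + x)) (+-identityʳ k)) (sym (+-suc k k))

  ∣s∣≡k⇒∣∁s∣≡1+k : (s : Subset (suc (2 * k))) → ∣ s ∣ ≡ k → ∣ ∁ s ∣ ≡ suc k
  ∣s∣≡k⇒∣∁s∣≡1+k s ∣s∣≡k = begin
    ∣ ∁ s ∣                ≡⟨ ∣∁p∣≡n∸∣p∣ s ⟩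
    suc (2 * k) ∸ ∣ s ∣    ≡⟨ cong₂ _∸_ 2k+1≡k+[1+k] ∣s∣≡k ⟩
    k + suc k ∸ k          ≡⟨ m+n∸m≡n k (suc k) ⟩
    suc k                  ∎

  ∣s∣≡1+k⇒∣∁s∣≡k : (s : Subset (suc (2 * k))) → ∣ s ∣ ≡ suc k → ∣ ∁ s ∣ ≡ k
  ∣s∣≡1+k⇒∣∁s∣≡k s ∣s∣≡1+k = begin
    ∣ ∁ s ∣                ≡⟨ ∣∁p∣≡n∸∣p∣ s ⟩
    suc (2 * k) ∸ ∣ s ∣    ≡⟨ cong₂ _∸_ 2k+1≡k+[1+k] ∣s∣≡1+k ⟩
    k + suc k ∸ suc k      ≡⟨ m+n∸n≡m k (suc k) ⟩
    k                      ∎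

  OddGraph-≡ : {x y : V (OddGraph k)} → proj₁ x ≡ proj₁ y → x ≡ y
  OddGraph-≡ {s , a} {.s , b} refl = cong (s ,_) (≡-irrelevant a b)

  s≢∁t : {s t : Subset (suc (2 * k))} → ∣ s ∣ ≡ k → ∣ t ∣ ≡ k → s ≢ ∁ t
  s≢∁t {s} {t} ∣s∣≡k ∣t∣≡k s≡∁t = 1+n≢n (begin
    suc k    ≡⟨ ∣s∣≡k⇒∣∁s∣≡1+k t ∣t∣≡k ⟨
    ∣ ∁ t ∣  ≡⟨ cong ∣_∣ s≡∁t ⟨
    ∣ s ∣    ≡⟨ ∣s∣≡k ⟩
    k        ∎)

  toMiddleLevels : V (DoubleCover (OddGraph k)) → V (MiddleLevels k)
  toMiddleLevels ((s , ∣s∣≡k) , 0ℙ) = s , inj₁ ∣s∣≡k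
  toMiddleLevels ((s , ∣s∣≡k) , 1ℙ) = ∁ s , inj₂ (∣s∣≡k⇒∣∁s∣≡1+k s ∣s∣≡k)

  toMiddleLevels-adj : ∀ {x y} → Adj (DoubleCover (OddGraph k)) x y →
                       Adj (MiddleLevels k) (toMiddleLevels x) (toMiddleLevels y)
  toMiddleLevels-adj {_ , 0ℙ} (s∩t≡∅ , refl) = inj₁ (Empty[p∩q]⇒p⊆∁q s∩t≡∅)
  toMiddleLevels-adj {_ , 1ℙ} (s∩t≡∅ , refl) = inj₂ (Empty[p∩q]⇒q⊆∁p s∩t≡∅)

  toMiddleLevels-injective : Injective _≡_ _≡_ toMiddleLevels
  toMiddleLevels-injective {_ , 0ℙ} {_ , 0ℙ} e = cong (_, 0ℙ) (OddGraph-≡ (cong proj₁ e))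
  toMiddleLevels-injective {_ , 1ℙ} {_ , 1ℙ} e = cong (_, 1ℙ) (OddGraph-≡ (∁-injective (cong proj₁ e)))
  toMiddleLevels-injective {(_ , ∣s∣≡k) , 0ℙ} {(_ , ∣t∣≡k) , 1ℙ} e =
    ⊥-elim (s≢∁t ∣s∣≡k ∣t∣≡k (cong proj₁ e))
  toMiddleLevels-injective {(_ , ∣s∣≡k) , 1ℙ} {(_ , ∣t∣≡k) , 0ℙ} e =
    ⊥-elim (s≢∁t ∣t∣≡k ∣s∣≡k (sym (cong proj₁ e)))

  toMiddleLevels-surjective : StrictlySurjective _≡_ toMiddleLevels
  toMiddleLevels-surjective (s , inj₁ ∣s∣≡k)   = ((s , ∣s∣≡k) , 0ℙ) , refl
  toMiddleLevels-surjective (s , inj₂ ∣s∣≡1+k) =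
    ((∁ s , ∣s∣≡1+k⇒∣∁s∣≡k s ∣s∣≡1+k) , 1ℙ) , upper-≡ (∁-involutive s)
    where
    upper-≡ : ∀ {t} → t ≡ s → ∀ {a b} → _≡_ {A = V (MiddleLevels k)} (t , inj₂ a) (s , inj₂ b)
    upper-≡ refl = cong (λ e → s , inj₂ e) (≡-irrelevant _ _)

lemma15 : (k m : ℕ) → 1 ≤ k → 3 ≤ suc (2 * m) →
    CFactor (suc (2 * m)) (OddGraph k) → CFactor (2 * suc (2 * m)) (MiddleLevels k)
lemma15 k m _ _ =
  CFactor-map (toMiddleLevels k) (toMiddleLevels-injective k) (toMiddleLevels-surjective k)
              (toMiddleLevels-adj k)
  ∘ doubleCover-CFactor m
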